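{- For all formulas $A,B$ of the language of BL (resp. CBL), if the sequent $A\vdash B$ is derivable in the calculus BL (resp. CBL), then $t_1(A)\vdash t_1(B)$ is derivable in the display calculus D.BL (resp. D.CBL).
   Context: Language $\mathcal{L}$ of BL over a countable set of atoms: $A::=p\mid\texttt{t}\mid\texttt{f}\mid\top\mid\bot\mid\neg A\mid A\wedge A\mid A\vee A\mid A\otimes A\mid A\oplus A$; CBL adds $-A$. The calculus BL derives sequents $A\vdash B$ of single formulas; $A\dashv\vdash B$ abbreviates both $A\vdash B$ and $B\vdash A$. Axioms: $A\vdash A$; $\neg\neg A\dashv\vdash A$; $\texttt{f}\vdash A$; $A\vdash\texttt{t}$; $\bot\vdash A$; $A\vdash\top$; $A\vdash\neg\texttt{f}$; $\neg\texttt{t}\vdash A$; $\neg\bot\vdash A$; $A\vdash\neg\top$; $A\wedge B\vdash A$; $A\wedge B\vdash B$; $A\vdash A\vee B$; $B\vdash A\vee B$; $A\otimes B\vdash A$; $A\otimes B\vdash B$; $A\vdash A\oplus B$; $B\vdash A\oplus B$; $A\wedge(B\vee C)\vdash(A\wedge B)\vee(A\wedge C)$; $A\otimes(B\oplus C)\vdash(A\otimes B)\vee(A\oplus C)$; $\neg(A\wedge B)\dashv\vdash\neg A\vee\neg B$; $\neg(A\vee B)\dashv\vdash\neg A\wedge\neg B$; $\neg(A\otimes B)\dashv\vdash\neg A\otimes\neg B$; $\neg(A\oplus B)\dashv\vdash\neg A\oplus\neg B$. Rules: from $A\vdash B$, $B\vdash C$ infer $A\vdash C$; from $A\vdash B$,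 $A\vdash C$ infer $A\vdash B\wedge C$ and $A\vdash B\otimes C$; from $A\vdash B$, $C\vdash B$ infer $A\vee C\vdash B$ and $A\oplus C\vdash B$. CBL adds the axioms $--A\dashv\vdash A$; $-\neg A\dashv\vdash\neg-A$; $-\texttt{f}\vdash A$; $A\vdash-\texttt{t}$; $-\top\vdash A$; $A\vdash-\bot$; $-(A\wedge B)\dashv\vdash-A\wedge-B$; $-(A\vee B)\dashv\vdash-A\vee-B$; $-(A\otimes B)\dashv\vdash-A\oplus-B$; $-(A\oplus B)\dashv\vdash-A\otimes-B$. The calculus D.BL has two types $i\in\{1,2\}$. For each atom $p$ there are atoms $p_1$ (type 1) and $p_2$ (type 2). Type-1 formulas: $A_1::=p_1\mid 1_1\mid 0_1\mid \mathrm{p}A_2\mid A_1\sqcap_1A_1\mid A_1\sqcup_1A_1$; type-2 formulas: $A_2::=p_2\mid1_2\mid0_2\mid\mathrm{n}A_1\mid A_2\sqcap_2A_2\mid A_2\sqcup_2A_2$. Type-$i$ structures: $X_i::=A_i\mid\hat1_i\mid\check0_i\mid X_i\hat\sqcap_iX_i\mid X_i\check\sqcup_iX_i\mid X_i\check\sqsupset_iX_i\mid X_i\hat\sqsubset_iX_i$, plus $\mathrm{P}X_2$ as type-1 and $\mathrm{N}X_1$ as type-2 structures. Sequents $X_i\vdash Y_i$ have both sides of the same type. D.CBL adds formulas ${\sim}_iA_i$ and structures $\ast_iX_i$. Rules (for $i\in\{1,2\}$; "$\Leftrightarrow$" means the rule in both directions): Display: $X_i\hat\sqcap_iY_i\vdash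 Z_i\Leftrightarrow X_i\vdash Y_i\check\sqsupset_iZ_i$; $X_i\vdash Y_i\check\sqcup_iZ_i\Leftrightarrow X_i\hat\sqsubset_iY_i\vdash Z_i$; $\mathrm{P}X_2\vdash Y_1\Leftrightarrow X_2\vdash\mathrm{N}Y_1$; $\mathrm{N}X_1\vdash Y_2\Leftrightarrow X_1\vdash\mathrm{P}Y_2$. Identity/cut: axiom $p_i\vdash p_i$; from $X_i\vdash A_i$ and $A_i\vdash Y_i$ infer $X_i\vdash Y_i$. Structural: from $X_i\hat\sqcap_i\hat1_i\vdash Y_i$ infer $X_i\vdash Y_i$; from $X_i\vdash Y_i\check\sqcup_i\check0_i$ infer $X_i\vdash Y_i$; exchange, associativity, weakening ($X\vdash Z$ / $X\hat\sqcap Y\vdash Z$ and $X\vdash Y$ / $X\vdash Y\check\sqcup Z$) and contraction ($X\hat\sqcap X\vdash Z$ / $X\vdash Z$ and $X\vdash Y\check\sqcup Y$ / $X\vdash Y$) for $\hat\sqcap_i$ on the left and $\check\sqcup_i$ on the right. Operational: from $\hat1_i\vdash X_i$ infer $1_i\vdash X_i$; axiom $\hat1_i\vdash1_i$; axiom $0_i\vdash\check0_i$; from $X_i\vdash\check0_i$ infer $X_i\vdash0_i$; from $A_i\hat\sqcap_iB_i\vdash X_i$ infer $A_i\sqcap_iB_i\vdash X_i$; from $X_i\vdash A_i$, $Y_i\vdash B_i$ infer $X_i\hat\sqcap_iY_i\vdash A_i\sqcap_iB_i$; from $A_i\vdash X_i$, $B_i\vdash Y_i$ infer $A_i\sqcup_iB_i\vdash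 X_i\check\sqcup_iY_i$; from $X_i\vdash A_i\check\sqcup_iB_i$ infer $X_i\vdash A_i\sqcup_iB_i$. Multi-type structural: $X_1\vdash Y_1\Leftrightarrow\mathrm{N}X_1\vdash\mathrm{N}Y_1$; $X_2\vdash Y_2\Leftrightarrow\mathrm{P}X_2\vdash\mathrm{P}Y_2$; from $\check0_1\vdash X_1$ infer $\mathrm{P}\check0_2\vdash X_1$; from $X_1\vdash\hat1_1$ infer $X_1\vdash\mathrm{P}\hat1_2$. Multi-type operational: from $\mathrm{N}A_1\vdash X_2$ infer $\mathrm{n}A_1\vdash X_2$; from $X_2\vdash\mathrm{N}A_1$ infer $X_2\vdash\mathrm{n}A_1$; from $\mathrm{P}A_2\vdash X_1$ infer $\mathrm{p}A_2\vdash X_1$; from $X_1\vdash\mathrm{P}A_2$ infer $X_1\vdash\mathrm{p}A_2$. D.CBL additionally: $\ast_iX_i\vdash Y_i\Leftrightarrow\ast_iY_i\vdash X_i$; $X_i\vdash\ast_iY_i\Leftrightarrow Y_i\vdash\ast_iX_i$; $X_i\vdash Y_i\Leftrightarrow\ast_iY_i\vdash\ast_iX_i$; from $\mathrm{N}\ast_1X_1\vdash Y_2$ infer $\ast_2\mathrm{N}X_1\vdash Y_2$; from $X_2\vdash\mathrm{N}\ast_1Y_1$ infer $X_2\vdash\ast_2\mathrm{N}Y_1$; from $\ast_iA_i\vdash Y_i$ infer ${\sim}_iA_i\vdash Y_i$; from $X_i\vdash\ast_iA_i$ infer $X_i\vdash{\sim}_iA_i$. Translations $t_1,t_2$: $t_1(p)=p_1$,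 $t_2(p)=p_2$; $t_1(\texttt{t})=1_1$, $t_2(\texttt{t})=0_2$; $t_1(\texttt{f})=0_1$, $t_2(\texttt{f})=1_2$; $t_1(\top)=1_1$, $t_2(\top)=1_2$; $t_1(\bot)=0_1$, $t_2(\bot)=0_2$; $t_1(A\wedge B)=t_1A\sqcap_1t_1B$, $t_2(A\wedge B)=t_2A\sqcup_2t_2B$; $t_1(A\vee B)=t_1A\sqcup_1t_1B$, $t_2(A\vee B)=t_2A\sqcap_2t_2B$; $t_1(A\otimes B)=t_1A\sqcap_1t_1B$, $t_2(A\otimes B)=t_2A\sqcap_2t_2B$; $t_1(A\oplus B)=t_1A\sqcup_1t_1B$, $t_2(A\oplus B)=t_2A\sqcup_2t_2B$; $t_1(\neg A)=\mathrm{p}\,t_2(A)$, $t_2(\neg A)=\mathrm{n}\,t_1(A)$; $t_1(-A)=\mathrm{p}{\sim}_2t_2(A)$, $t_2(-A)=\mathrm{n}{\sim}_1t_1(A)$. -}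

module Defs where

open import Data.Nat using (ℕ)

-- Which logic: BL (bilattice logic) or CBL (with conflation -A).
-- Formulas of CBL may use `-_`; formulas of BL may not.

data Logic : Set where
  bl cbl : Logic

infix  30 ¬_ -_
infixr 20 _∧_ _∨_ _⊗_ _⊕_

data Fm : Logic → Set where
  atom : ∀ {L} → ℕ → Fm L
  𝐭 𝐟 ⊤ᶠ ⊥ᶠ : ∀ {L} → Fm L
  ¬_ : ∀ {L} → Fm L → Fm L
  _∧_ _∨_ _⊗_ _⊕_ : ∀ {L} → Fm L → Fm L → Fm L
  -_ : Fm cbl → Fm cbl

-- The Hilbert-style sequent calculi BL and CBL (A ⊢ B, single formulas).
-- Constructors mentioning only `Fm L` are the BL rules; those restricted
-- to `Fm cbl` are the additional CBL axioms.

infix 4 _⊢_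

private variable L : Logic

data _⊢_ : {L : Logic} → Fm L → Fm L → Set where
  id    : ∀ {A : Fm L} → A ⊢ A
  ¬¬e   : ∀ {A : Fm L} → ¬ ¬ A ⊢ A
  ¬¬i   : ∀ {A : Fm L} → A ⊢ ¬ ¬ A
  𝐟⊢    : ∀ {A : Fm L} → 𝐟 ⊢ A
  ⊢𝐭    : ∀ {A : Fm L} → A ⊢ 𝐭
  ⊥⊢    : ∀ {A : Fm L} → ⊥ᶠ ⊢ A
  ⊢⊤    : ∀ {A : Fm L} → A ⊢ ⊤ᶠ
  ⊢¬𝐟   : ∀ {A : Fm L} → A ⊢ ¬ 𝐟
  ¬𝐭⊢   : ∀ {A : Fm L} → ¬ 𝐭 ⊢ A
  ¬⊥⊢   : ∀ {A : Fm L} → ¬ ⊥ᶠ ⊢ A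
  ⊢¬⊤   : ∀ {A : Fm L} → A ⊢ ¬ ⊤ᶠ
  ∧e₁   : ∀ {A B : Fm L} → A ∧ B ⊢ A
  ∧e₂   : ∀ {A B : Fm L} → A ∧ B ⊢ B
  ∨i₁   : ∀ {A B : Fm L} → A ⊢ A ∨ B
  ∨i₂   : ∀ {A B : Fm L} → B ⊢ A ∨ B
  ⊗e₁   : ∀ {A B : Fm L} → A ⊗ B ⊢ A
  ⊗e₂   : ∀ {A B : Fm L} → A ⊗ B ⊢ B
  ⊕i₁   : ∀ {A B : Fm L} → A ⊢ A ⊕ B
  ⊕i₂   : ∀ {A B : Fm L} → B ⊢ A ⊕ B
  dist∧∨ : ∀ {A B C : Fm L} → A ∧ (B ∨ C) ⊢ (A ∧ B) ∨ (A ∧ C)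
  dist⊗⊕ : ∀ {A B C : Fm L} → A ⊗ (B ⊕ C) ⊢ (A ⊗ B) ∨ (A ⊕ C)
  ¬∧₁   : ∀ {A B : Fm L} → ¬ (A ∧ B) ⊢ ¬ A ∨ ¬ B
  ¬∧₂   : ∀ {A B : Fm L} → ¬ A ∨ ¬ B ⊢ ¬ (A ∧ B)
  ¬∨₁   : ∀ {A B : Fm L} → ¬ (A ∨ B) ⊢ ¬ A ∧ ¬ B
  ¬∨₂   : ∀ {A B : Fm L} → ¬ A ∧ ¬ B ⊢ ¬ (A ∨ B)
  ¬⊗₁   : ∀ {A B : Fm L} → ¬ (A ⊗ B) ⊢ ¬ A ⊗ ¬ B
  ¬⊗₂   : ∀ {A B : Fm L} → ¬ A ⊗ ¬ B ⊢ ¬ (A ⊗ B)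
  ¬⊕₁   : ∀ {A B : Fm L} → ¬ (A ⊕ B) ⊢ ¬ A ⊕ ¬ B
  ¬⊕₂   : ∀ {A B : Fm L} → ¬ A ⊕ ¬ B ⊢ ¬ (A ⊕ B)
  cut   : ∀ {A B C : Fm L} → A ⊢ B → B ⊢ C → A ⊢ C
  ∧r    : ∀ {A B C : Fm L} → A ⊢ B → A ⊢ C → A ⊢ B ∧ C
  ⊗r    : ∀ {A B C : Fm L} → A ⊢ B → A ⊢ C → A ⊢ B ⊗ C
  ∨l    : ∀ {A B C : Fm L} → A ⊢ B → C ⊢ B → A ∨ C ⊢ B
  ⊕l    : ∀ {A B C : Fm L} → A ⊢ B → C ⊢ B → A ⊕ C ⊢ B
  dnege : ∀ {A : Fm cbl} → - - A ⊢ A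
  dnegi : ∀ {A : Fm cbl} → A ⊢ - - A
  -¬₁   : ∀ {A : Fm cbl} → - ¬ A ⊢ ¬ - A
  -¬₂   : ∀ {A : Fm cbl} → ¬ - A ⊢ - ¬ A
  -𝐟⊢   : ∀ {A : Fm cbl} → - 𝐟 ⊢ A
  ⊢-𝐭   : ∀ {A : Fm cbl} → A ⊢ - 𝐭
  -⊤⊢   : ∀ {A : Fm cbl} → - ⊤ᶠ ⊢ A
  ⊢-⊥   : ∀ {A : Fm cbl} → A ⊢ - ⊥ᶠ
  -∧₁   : ∀ {A B : Fm cbl} → - (A ∧ B) ⊢ - A ∧ - B
  -∧₂   : ∀ {A B : Fm cbl} → - A ∧ - B ⊢ - (A ∧ B)
  -∨₁   : ∀ {A B : Fm cbl} → - (A ∨ B) ⊢ - A ∨ - B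
  -∨₂   : ∀ {A B : Fm cbl} → - A ∨ - B ⊢ - (A ∨ B)
  -⊗₁   : ∀ {A B : Fm cbl} → - (A ⊗ B) ⊢ - A ⊕ - B
  -⊗₂   : ∀ {A B : Fm cbl} → - A ⊕ - B ⊢ - (A ⊗ B)
  -⊕₁   : ∀ {A B : Fm cbl} → - (A ⊕ B) ⊢ - A ⊗ - B
  -⊕₂   : ∀ {A B : Fm cbl} → - A ⊗ - B ⊢ - (A ⊕ B)

data Ty : Set where
  ₁ ₂ : Ty

infix  30 ~_ *_
infixr 20 _⊓_ _⊔_ _⊓̂_ _⊔̌_ _⊐̌_ _⊏̂_

data DFm : Logic → Ty → Set where
  atomᴰ : ∀ {L i} → ℕ → DFm L i
  1ᴰ 0ᴰ : ∀ {L i} → DFm L i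
  p     : ∀ {L} → DFm L ₂ → DFm L ₁
  n     : ∀ {L} → DFm L ₁ → DFm L ₂
  _⊓_ _⊔_ : ∀ {L i} → DFm L i → DFm L i → DFm L i
  ~_    : ∀ {i} → DFm cbl i → DFm cbl i

data DSt : Logic → Ty → Set where
  ⌜_⌝   : ∀ {L i} → DFm L i → DSt L i
  1̂ 0̌   : ∀ {L i} → DSt L i
  _⊓̂_ _⊔̌_ _⊐̌_ _⊏̂_ : ∀ {L i} → DSt L i → DSt L i → DSt L i
  P     : ∀ {L} → DSt L ₂ → DSt L ₁
  N     : ∀ {L} → DSt L ₁ → DSt L ₂
  *_    : ∀ {i} → DSt cbl i → DSt cbl i

infix 4 _⊢ᴰ_

data _⊢ᴰ_ : {L : Logic} {i : Ty} → DSt L i → DSt L i → Set where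
  res⊓→ : ∀ {i} {X Y Z : DSt L i} → X ⊓̂ Y ⊢ᴰ Z → X ⊢ᴰ Y ⊐̌ Z
  res⊓← : ∀ {i} {X Y Z : DSt L i} → X ⊢ᴰ Y ⊐̌ Z → X ⊓̂ Y ⊢ᴰ Z
  res⊔→ : ∀ {i} {X Y Z : DSt L i} → X ⊢ᴰ Y ⊔̌ Z → X ⊏̂ Y ⊢ᴰ Z
  res⊔← : ∀ {i} {X Y Z : DSt L i} → X ⊏̂ Y ⊢ᴰ Z → X ⊢ᴰ Y ⊔̌ Z
  resPN→ : ∀ {X : DSt L ₂} {Y : DSt L ₁} → P X ⊢ᴰ Y → X ⊢ᴰ N Y
  resPN← : ∀ {X : DSt L ₂} {Y : DSt L ₁} → X ⊢ᴰ N Y → P X ⊢ᴰ Y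
  resNP→ : ∀ {X : DSt L ₁} {Y : DSt L ₂} → N X ⊢ᴰ Y → X ⊢ᴰ P Y
  resNP← : ∀ {X : DSt L ₁} {Y : DSt L ₂} → X ⊢ᴰ P Y → N X ⊢ᴰ Y
  idᴰ   : ∀ {i} {q : ℕ} → ⌜ atomᴰ {L} {i} q ⌝ ⊢ᴰ ⌜ atomᴰ q ⌝
  cutᴰ  : ∀ {i} {X Y : DSt L i} {A : DFm L i} → X ⊢ᴰ ⌜ A ⌝ → ⌜ A ⌝ ⊢ᴰ Y → X ⊢ᴰ Y
  1̂e    : ∀ {i} {X Y : DSt L i} → X ⊓̂ 1̂ ⊢ᴰ Y → X ⊢ᴰ Y
  0̌e    : ∀ {i} {X Y : DSt L i} → X ⊢ᴰ Y ⊔̌ 0̌ → X ⊢ᴰ Y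
  exL   : ∀ {i} {X Y Z : DSt L i} → X ⊓̂ Y ⊢ᴰ Z → Y ⊓̂ X ⊢ᴰ Z
  exR   : ∀ {i} {X Y Z : DSt L i} → X ⊢ᴰ Y ⊔̌ Z → X ⊢ᴰ Z ⊔̌ Y
  asL→  : ∀ {i} {X Y Z W : DSt L i} → (X ⊓̂ Y) ⊓̂ Z ⊢ᴰ W → X ⊓̂ (Y ⊓̂ Z) ⊢ᴰ W
  asL←  : ∀ {i} {X Y Z W : DSt L i} → X ⊓̂ (Y ⊓̂ Z) ⊢ᴰ W → (X ⊓̂ Y) ⊓̂ Z ⊢ᴰ W
  asR→  : ∀ {i} {W X Y Z : DSt L i} → W ⊢ᴰ (X ⊔̌ Y) ⊔̌ Z → W ⊢ᴰ X ⊔̌ (Y ⊔̌ Z)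
  asR←  : ∀ {i} {W X Y Z : DSt L i} → W ⊢ᴰ X ⊔̌ (Y ⊔̌ Z) → W ⊢ᴰ (X ⊔̌ Y) ⊔̌ Z
  wL    : ∀ {i} {X Y Z : DSt L i} → X ⊢ᴰ Z → X ⊓̂ Y ⊢ᴰ Z
  wR    : ∀ {i} {X Y Z : DSt L i} → X ⊢ᴰ Y → X ⊢ᴰ Y ⊔̌ Z
  cL    : ∀ {i} {X Z : DSt L i} → X ⊓̂ X ⊢ᴰ Z → X ⊢ᴰ Z
  cR    : ∀ {i} {X Y : DSt L i} → X ⊢ᴰ Y ⊔̌ Y → X ⊢ᴰ Y
  1L    : ∀ {i} {X : DSt L i} → 1̂ ⊢ᴰ X → ⌜ 1ᴰ ⌝ ⊢ᴰ X
  1R    : ∀ {i} → 1̂ {L} {i} ⊢ᴰ ⌜ 1ᴰ ⌝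
  0L    : ∀ {i} → ⌜ 0ᴰ {L} {i} ⌝ ⊢ᴰ 0̌
  0R    : ∀ {i} {X : DSt L i} → X ⊢ᴰ 0̌ → X ⊢ᴰ ⌜ 0ᴰ ⌝
  ⊓L    : ∀ {i} {A B : DFm L i} {X : DSt L i} → ⌜ A ⌝ ⊓̂ ⌜ B ⌝ ⊢ᴰ X → ⌜ A ⊓ B ⌝ ⊢ᴰ X
  ⊓R    : ∀ {i} {A B : DFm L i} {X Y : DSt L i} → X ⊢ᴰ ⌜ A ⌝ → Y ⊢ᴰ ⌜ B ⌝ → X ⊓̂ Y ⊢ᴰ ⌜ A ⊓ B ⌝
  ⊔L    : ∀ {i} {A B : DFm L i} {X Y : DSt L i} → ⌜ A ⌝ ⊢ᴰ X → ⌜ B ⌝ ⊢ᴰ Y → ⌜ A ⊔ B ⌝ ⊢ᴰ X ⊔̌ Y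
  ⊔R    : ∀ {i} {A B : DFm L i} {X : DSt L i} → X ⊢ᴰ ⌜ A ⌝ ⊔̌ ⌜ B ⌝ → X ⊢ᴰ ⌜ A ⊔ B ⌝
  N→    : ∀ {X Y : DSt L ₁} → X ⊢ᴰ Y → N X ⊢ᴰ N Y
  N←    : ∀ {X Y : DSt L ₁} → N X ⊢ᴰ N Y → X ⊢ᴰ Y
  P→    : ∀ {X Y : DSt L ₂} → X ⊢ᴰ Y → P X ⊢ᴰ P Y
  P←    : ∀ {X Y : DSt L ₂} → P X ⊢ᴰ P Y → X ⊢ᴰ Y
  P0̌    : ∀ {X : DSt L ₁} → 0̌ ⊢ᴰ X → P 0̌ ⊢ᴰ X
  P1̂    : ∀ {X : DSt L ₁} → X ⊢ᴰ 1̂ → X ⊢ᴰ P 1̂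
  nL    : ∀ {A : DFm L ₁} {X : DSt L ₂} → N ⌜ A ⌝ ⊢ᴰ X → ⌜ n A ⌝ ⊢ᴰ X
  nR    : ∀ {A : DFm L ₁} {X : DSt L ₂} → X ⊢ᴰ N ⌜ A ⌝ → X ⊢ᴰ ⌜ n A ⌝
  pL    : ∀ {A : DFm L ₂} {X : DSt L ₁} → P ⌜ A ⌝ ⊢ᴰ X → ⌜ p A ⌝ ⊢ᴰ X
  pR    : ∀ {A : DFm L ₂} {X : DSt L ₁} → X ⊢ᴰ P ⌜ A ⌝ → X ⊢ᴰ ⌜ p A ⌝
  *L→   : ∀ {i} {X Y : DSt cbl i} → * X ⊢ᴰ Y → * Y ⊢ᴰ X
  *R→   : ∀ {i} {X Y : DSt cbl i} → X ⊢ᴰ * Y → Y ⊢ᴰ * X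
  **→   : ∀ {i} {X Y : DSt cbl i} → X ⊢ᴰ Y → * Y ⊢ᴰ * X
  **←   : ∀ {i} {X Y : DSt cbl i} → * Y ⊢ᴰ * X → X ⊢ᴰ Y
  N*L   : ∀ {X : DSt cbl ₁} {Y : DSt cbl ₂} → N (* X) ⊢ᴰ Y → * (N X) ⊢ᴰ Y
  N*R   : ∀ {X : DSt cbl ₂} {Y : DSt cbl ₁} → X ⊢ᴰ N (* Y) → X ⊢ᴰ * (N Y)
  ~L    : ∀ {i} {A : DFm cbl i} {Y : DSt cbl i} → * ⌜ A ⌝ ⊢ᴰ Y → ⌜ ~ A ⌝ ⊢ᴰ Y
  ~R    : ∀ {i} {A : DFm cbl i} {X : DSt cbl i} → X ⊢ᴰ * ⌜ A ⌝ → X ⊢ᴰ ⌜ ~ A ⌝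

t : ∀ {L} (i : Ty) → Fm L → DFm L i
t ₁ (atom q) = atomᴰ q
t ₂ (atom q) = atomᴰ q
t ₁ 𝐭 = 1ᴰ
t ₂ 𝐭 = 0ᴰ
t ₁ 𝐟 = 0ᴰ
t ₂ 𝐟 = 1ᴰ
t ₁ ⊤ᶠ = 1ᴰ
t ₂ ⊤ᶠ = 1ᴰ
t ₁ ⊥ᶠ = 0ᴰ
t ₂ ⊥ᶠ = 0ᴰ
t ₁ (A ∧ B) = t ₁ A ⊓ t ₁ B
t ₂ (A ∧ B) = t ₂ A ⊔ t ₂ B
t ₁ (A ∨ B) = t ₁ A ⊔ t ₁ B
t ₂ (A ∨ B) = t ₂ A ⊓ t ₂ B
t ₁ (A ⊗ B) = t ₁ A ⊓ t ₁ B
t ₂ (A ⊗ B) = t ₂ A ⊓ t ₂ B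
t ₁ (A ⊕ B) = t ₁ A ⊔ t ₁ B
t ₂ (A ⊕ B) = t ₂ A ⊔ t ₂ B
t ₁ (¬ A) = p (t ₂ A)
t ₂ (¬ A) = n (t ₁ A)
t ₁ (- A) = p (~ (t ₂ A))
t ₂ (- A) = n (~ (t ₁ A))

-- The translation t₁ turns every axiom of BL/CBL into an order-theoretic fact about
-- the two types of D.BL/D.CBL, read as preorders a ≤ᴰ b = ⌜ a ⌝ ⊢ᴰ ⌜ b ⌝: each type
-- is a bounded lattice with ⊓ distributing over ⊔ (weakening, contraction and
-- residuation), p and n are mutually inverse monotone maps (the display rules
-- P ⊣ N together with the structural rules N→ and P→), and ~ is an antitone
-- involution (the rules for *). So p and ~ preserve, respectively reverse, the
-- lattice operations, which is what the De Morgan axioms for ¬ and - say, and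
-- the theorem follows by induction on derivations, with cut becoming cutᴰ.
module Submission where

open import Defs

private
  variable
    L : Logic
    i : Ty

infix 4 _≤ᴰ_

_≤ᴰ_ : DFm L i → DFm L i → Set
a ≤ᴰ b = ⌜ a ⌝ ⊢ᴰ ⌜ b ⌝

infixr 5 _⨾_

_⨾_ : {X Y : DSt L i} {a : DFm L i} → X ⊢ᴰ ⌜ a ⌝ → ⌜ a ⌝ ⊢ᴰ Y → X ⊢ᴰ Y
_⨾_ = cutᴰ

≤ᴰ-refl : {a : DFm L i} → a ≤ᴰ a
≤ᴰ-refl {a = atomᴰ q} = idᴰ
≤ᴰ-refl {a = 1ᴰ}      = 1L 1R
≤ᴰ-refl {a = 0ᴰ}      = 0R 0L
≤ᴰ-refl {a = p a}     = pL (pR (P→ ≤ᴰ-refl))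
≤ᴰ-refl {a = n a}     = nL (nR (N→ ≤ᴰ-refl))
≤ᴰ-refl {a = a ⊓ b}   = ⊓L (⊓R ≤ᴰ-refl ≤ᴰ-refl)
≤ᴰ-refl {a = a ⊔ b}   = ⊔R (⊔L ≤ᴰ-refl ≤ᴰ-refl)
≤ᴰ-refl {a = ~ a}     = ~L (~R (**→ ≤ᴰ-refl))

x⊓y≤x : {a b : DFm L i} → a ⊓ b ≤ᴰ a
x⊓y≤x = ⊓L (wL ≤ᴰ-refl)

x⊓y≤y : {a b : DFm L i} → a ⊓ b ≤ᴰ b
x⊓y≤y = ⊓L (exL (wL ≤ᴰ-refl))

⊓-greatest : {a b : DFm L i} {X : DSt L i} → X ⊢ᴰ ⌜ a ⌝ → X ⊢ᴰ ⌜ b ⌝ → X ⊢ᴰ ⌜ a ⊓ b ⌝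
⊓-greatest d e = cL (⊓R d e)

x≤x⊔y : {a b : DFm L i} → a ≤ᴰ a ⊔ b
x≤x⊔y = ⊔R (wR ≤ᴰ-refl)

y≤x⊔y : {a b : DFm L i} → b ≤ᴰ a ⊔ b
y≤x⊔y = ⊔R (exR (wR ≤ᴰ-refl))

⊔-least : {a b : DFm L i} {Y : DSt L i} → ⌜ a ⌝ ⊢ᴰ Y → ⌜ b ⌝ ⊢ᴰ Y → ⌜ a ⊔ b ⌝ ⊢ᴰ Y
⊔-least d e = cR (⊔L d e)

1-maximum : {X : DSt L i} → X ⊢ᴰ ⌜ 1ᴰ ⌝
1-maximum = 1̂e (exL (wL 1R))

0-minimum : {Y : DSt L i} → ⌜ 0ᴰ ⌝ ⊢ᴰ Y
0-minimum = 0̌e (exR (wR 0L))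

⊓-residual : {a b d : DFm L i} → a ⊓ b ≤ᴰ d → ⌜ b ⌝ ⊢ᴰ ⌜ a ⌝ ⊐̌ ⌜ d ⌝
⊓-residual e = res⊓→ (exL (⊓R ≤ᴰ-refl ≤ᴰ-refl ⨾ e))

-- With a residuated to the right, contraction of ⊔̌ splits b ⊔ c.
⊓-distribˡ-⊔ : {a b c : DFm L i} → a ⊓ (b ⊔ c) ≤ᴰ (a ⊓ b) ⊔ (a ⊓ c)
⊓-distribˡ-⊔ = ⊓L (exL (res⊓← (⊔-least (⊓-residual x≤x⊔y) (⊓-residual y≤x⊔y))))

p-mono : {a b : DFm L ₂} → a ≤ᴰ b → p a ≤ᴰ p b
p-mono d = pL (pR (P→ d))

n-mono : {a b : DFm L ₁} → a ≤ᴰ b → n a ≤ᴰ n b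
n-mono d = nL (nR (N→ d))

pna≤a : {a : DFm L ₁} → p (n a) ≤ᴰ a
pna≤a = pL (resPN← (nL (N→ ≤ᴰ-refl)))

a≤pna : {a : DFm L ₁} → a ≤ᴰ p (n a)
a≤pna = pR (resNP→ (nR (N→ ≤ᴰ-refl)))

p0-minimum : {Y : DSt L ₁} → ⌜ p 0ᴰ ⌝ ⊢ᴰ Y
p0-minimum = pL (resPN← 0-minimum)

p1-maximum : {X : DSt L ₁} → X ⊢ᴰ ⌜ p 1ᴰ ⌝
p1-maximum = pR (resNP→ 1-maximum)

p-⊔-≤ : {a b : DFm L ₂} → p (a ⊔ b) ≤ᴰ p a ⊔ p b
p-⊔-≤ = pL (resPN← (⊔-least (resPN→ (pR (P→ ≤ᴰ-refl) ⨾ x≤x⊔y))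
                             (resPN→ (pR (P→ ≤ᴰ-refl) ⨾ y≤x⊔y))))

p-⊔-≥ : {a b : DFm L ₂} → p a ⊔ p b ≤ᴰ p (a ⊔ b)
p-⊔-≥ = ⊔-least (p-mono x≤x⊔y) (p-mono y≤x⊔y)

p-⊓-≤ : {a b : DFm L ₂} → p (a ⊓ b) ≤ᴰ p a ⊓ p b
p-⊓-≤ = ⊓-greatest (p-mono x⊓y≤x) (p-mono x⊓y≤y)

p-⊓-≥ : {a b : DFm L ₂} → p a ⊓ p b ≤ᴰ p (a ⊓ b)
p-⊓-≥ = pR (resNP→ (⊓-greatest (resNP← (x⊓y≤x ⨾ pL (P→ ≤ᴰ-refl)))
                                (resNP← (x⊓y≤y ⨾ pL (P→ ≤ᴰ-refl)))))

~-antitone : {a b : DFm cbl i} → a ≤ᴰ b → ~ b ≤ᴰ ~ a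
~-antitone d = ~L (~R (**→ d))

~~a≤a : {a : DFm cbl i} → ~ ~ a ≤ᴰ a
~~a≤a = ~L (*L→ (~R (**→ ≤ᴰ-refl)))

a≤~~a : {a : DFm cbl i} → a ≤ᴰ ~ ~ a
a≤~~a = ~R (*R→ (~L (**→ ≤ᴰ-refl)))

~1≤0 : ~ 1ᴰ {cbl} {i} ≤ᴰ 0ᴰ
~1≤0 = ~-antitone 1-maximum ⨾ ~~a≤a

1≤~0 : 1ᴰ {cbl} {i} ≤ᴰ ~ 0ᴰ
1≤~0 = a≤~~a ⨾ ~-antitone 0-minimum

~-⊔-≤ : {a b : DFm cbl i} → ~ (a ⊔ b) ≤ᴰ ~ a ⊓ ~ b
~-⊔-≤ = ⊓-greatest (~-antitone x≤x⊔y) (~-antitone y≤x⊔y)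

~-⊔-≥ : {a b : DFm cbl i} → ~ a ⊓ ~ b ≤ᴰ ~ (a ⊔ b)
~-⊔-≥ = ~R (*R→ (⊔-least (*R→ (x⊓y≤x ⨾ ~L (**→ ≤ᴰ-refl)))
                         (*R→ (x⊓y≤y ⨾ ~L (**→ ≤ᴰ-refl)))))

~-⊓-≤ : {a b : DFm cbl i} → ~ (a ⊓ b) ≤ᴰ ~ a ⊔ ~ b
~-⊓-≤ = ~L (*L→ (⊓-greatest (*L→ (~R (**→ ≤ᴰ-refl) ⨾ x≤x⊔y))
                            (*L→ (~R (**→ ≤ᴰ-refl) ⨾ y≤x⊔y))))

~-⊓-≥ : {a b : DFm cbl i} → ~ a ⊔ ~ b ≤ᴰ ~ (a ⊓ b)
~-⊓-≥ = ⊔-least (~-antitone x⊓y≤x) (~-antitone x⊓y≤y)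

~n≤n~ : {a : DFm cbl ₁} → ~ (n a) ≤ᴰ n (~ a)
~n≤n~ = ~L (nR (*L→ (N*L (nR (N→ (*L→ (~R (**→ ≤ᴰ-refl))))))))

n~≤~n : {a : DFm cbl ₁} → n (~ a) ≤ᴰ ~ (n a)
n~≤~n = nL (~R (*R→ (N*R (nL (N→ (*R→ (~L (**→ ≤ᴰ-refl))))))))

t₁-sound : {A B : Fm L} → A ⊢ B → t ₁ A ≤ᴰ t ₁ B
t₁-sound id        = ≤ᴰ-refl
t₁-sound ¬¬e       = pna≤a
t₁-sound ¬¬i       = a≤pna
t₁-sound 𝐟⊢        = 0-minimum
t₁-sound ⊢𝐭        = 1-maximum
t₁-sound ⊥⊢        = 0-minimum
t₁-sound ⊢⊤        = 1-maximum
t₁-sound ⊢¬𝐟       = p1-maximum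
t₁-sound ¬𝐭⊢       = p0-minimum
t₁-sound ¬⊥⊢       = p0-minimum
t₁-sound ⊢¬⊤       = p1-maximum
t₁-sound ∧e₁       = x⊓y≤x
t₁-sound ∧e₂       = x⊓y≤y
t₁-sound ∨i₁       = x≤x⊔y
t₁-sound ∨i₂       = y≤x⊔y
t₁-sound ⊗e₁       = x⊓y≤x
t₁-sound ⊗e₂       = x⊓y≤y
t₁-sound ⊕i₁       = x≤x⊔y
t₁-sound ⊕i₂       = y≤x⊔y
t₁-sound dist∧∨    = ⊓-distribˡ-⊔
t₁-sound dist⊗⊕    = x⊓y≤x ⨾ x≤x⊔y ⨾ y≤x⊔y
t₁-sound ¬∧₁       = p-⊔-≤
t₁-sound ¬∧₂       = p-⊔-≥
t₁-sound ¬∨₁       = p-⊓-≤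
t₁-sound ¬∨₂       = p-⊓-≥
t₁-sound ¬⊗₁       = p-⊓-≤
t₁-sound ¬⊗₂       = p-⊓-≥
t₁-sound ¬⊕₁       = p-⊔-≤
t₁-sound ¬⊕₂       = p-⊔-≥
t₁-sound (cut d e) = t₁-sound d ⨾ t₁-sound e
t₁-sound (∧r d e)  = ⊓-greatest (t₁-sound d) (t₁-sound e)
t₁-sound (⊗r d e)  = ⊓-greatest (t₁-sound d) (t₁-sound e)
t₁-sound (∨l d e)  = ⊔-least (t₁-sound d) (t₁-sound e)
t₁-sound (⊕l d e)  = ⊔-least (t₁-sound d) (t₁-sound e)
t₁-sound dnege     = p-mono (~n≤n~ ⨾ n-mono ~~a≤a) ⨾ pna≤a
t₁-sound dnegi     = a≤pna ⨾ p-mono (n-mono a≤~~a ⨾ n~≤~n)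
t₁-sound -¬₁       = p-mono ~n≤n~
t₁-sound -¬₂       = p-mono n~≤~n
t₁-sound -𝐟⊢       = p-mono ~1≤0 ⨾ p0-minimum
t₁-sound ⊢-𝐭       = p1-maximum ⨾ p-mono 1≤~0
t₁-sound -⊤⊢       = p-mono ~1≤0 ⨾ p0-minimum
t₁-sound ⊢-⊥       = p1-maximum ⨾ p-mono 1≤~0
t₁-sound -∧₁       = p-mono ~-⊔-≤ ⨾ p-⊓-≤
t₁-sound -∧₂       = p-⊓-≥ ⨾ p-mono ~-⊔-≥
t₁-sound -∨₁       = p-mono ~-⊓-≤ ⨾ p-⊔-≤
t₁-sound -∨₂       = p-⊔-≥ ⨾ p-mono ~-⊓-≥
t₁-sound -⊗₁       = p-mono ~-⊓-≤ ⨾ p-⊔-≤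
t₁-sound -⊗₂       = p-⊔-≥ ⨾ p-mono ~-⊓-≥
t₁-sound -⊕₁       = p-mono ~-⊔-≤ ⨾ p-⊓-≤
t₁-sound -⊕₂       = p-⊓-≥ ⨾ p-mono ~-⊔-≥

proposition5 : (L : Logic) (A B : Fm L) → A ⊢ B → ⌜ t ₁ A ⌝ ⊢ᴰ ⌜ t ₁ B ⌝
proposition5 L A B = t₁-sound
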